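{- Let $G=(V,E)$ be a graph and $t\ge2$. If there exists a partition of $V$ into $t$ nonempty parts each of which induces a complete graph in $G$, then every such partition has density at least as large as the density of any partition of $V$ into $t$ nonempty parts.
   Context: For $S\subseteq V$, $d(S)=|E(S)|/|S|$ where $E(S)$ is the set of edges of $G$ with both endpoints in $S$. For a partition $\mathcal{P}=\{V_1,\dots,V_k\}$ of $V$ into nonempty parts, $d(\mathcal{P})=\sum_i d(V_i)$. -}

module Defs where

open import Data.Nat using (ℕ; zero; suc; _+_; _<ᵇ_)
open import Data.Bool using (Bool; true; false; _∧_; if_then_else_)
open import Data.Fin using (Fin; zero; suc; toℕ) renaming (_≟_ to _≟ᶠ_)
open import Data.Integer using (+_)
open import Data.Rational using (ℚ; 0ℚ; _/_) renaming (_+_ to _+ℚ_)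
open import Data.Product using (Σ; _×_)
open import Function.Definitions using (Surjective)
open import Relation.Binary.PropositionalEquality using (_≡_; _≢_)
open import Relation.Nullary.Decidable using (⌊_⌋)

record Graph (n : ℕ) : Set where
  field
    adj     : Fin n → Fin n → Bool
    adj-sym : ∀ u v → adj u v ≡ adj v u
    irrefl  : ∀ u → adj u u ≡ false
open Graph public

sumℕ : (k : ℕ) → (Fin k → ℕ) → ℕ
sumℕ zero    f = 0
sumℕ (suc k) f = f zero + sumℕ k (λ i → f (suc i))

sumℚ : (k : ℕ) → (Fin k → ℚ) → ℚ
sumℚ zero    f = 0ℚ
sumℚ (suc k) f = f zero +ℚ sumℚ k (λ i → f (suc i))

toN : Bool → ℕ
toN true  = 1
toN false = 0

Subset : ℕ → Set
Subset n = Fin n → Bool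

card : ∀ {n} → Subset n → ℕ
card {n} S = sumℕ n (λ u → toN (S u))

-- |E(S)|: edges {u,v} (counted once, via toℕ u < toℕ v) with both ends in S.
edgesIn : ∀ {n} → Graph n → Subset n → ℕ
edgesIn {n} G S =
  sumℕ n (λ u → sumℕ n (λ v →
    toN (adj G u v ∧ S u ∧ S v ∧ (toℕ u <ᵇ toℕ v))))

-- e / s as a rational (convention: value 0 when s = 0; only used for nonempty S).
ratio : ℕ → ℕ → ℚ
ratio e zero    = 0ℚ
ratio e (suc s) = (+ e) / suc s

density : ∀ {n} → Graph n → Subset n → ℚ
density G S = ratio (edgesIn G S) (card S)

-- A partition of V into t nonempty parts, given by a labelling p : V → Fin t
-- that is surjective (every part V_i = p⁻¹(i) is nonempty).
record Partition (n t : ℕ) : Set where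
  field
    label    : Fin n → Fin t
    nonempty : Surjective _≡_ _≡_ label
open Partition public

part : ∀ {n t} → Partition n t → Fin t → Subset n
part P i u = ⌊ label P u ≟ᶠ i ⌋

partDensity : ∀ {n t} → Graph n → Partition n t → ℚ
partDensity {n} {t} G P = sumℚ t (λ i → density G (part P i))

IsCliquePartition : ∀ {n t} → Graph n → Partition n t → Set
IsCliquePartition G P =
  ∀ u v → label P u ≡ label P v → u ≢ v → adj G u v ≡ true

module Submission where

-- A set S contains C(|S|,2) pairs, so it spans at most that many edges and
-- d(S) ≤ (|S| − 1)/2, with equality when S is a clique. Summing over the t nonempty
-- parts of a partition of n vertices gives d(𝒫) ≤ Σᵢ (|Vᵢ| − 1)/2 = (n − t)/2, and a
-- clique partition attains this value.

open import Defs
open import Data.Nat using (ℕ; _≤_)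
open import Data.Product using (Σ)
open import Data.Rational using () renaming (_≤_ to _≤ℚ_)

open import Data.Bool using (true; false; T; _∧_)
open import Data.Bool.Properties using (∧-identityʳ; ∧-zeroʳ; ∧-conicalˡ; ∧-conicalʳ; T-≡)
open import Data.Fin using (Fin; zero; suc; toℕ) renaming (_≟_ to _≟ᶠ_)
import Data.Integer as ℤ
import Data.Integer.Properties as ℤ
import Data.Integer.Tactic.RingSolver as ℤ-Solver
open import Data.Nat using (zero; suc; _+_; _*_; _∸_; _<ᵇ_; z≤n)
open import Data.Nat.Properties
import Data.Nat.Tactic.RingSolver as ℕ-Solver
open import Data.Product using (_,_)
open import Data.Rational as ℚ using (ℚ; toℚᵘ; fromℚᵘ)
import Data.Rational.Properties as ℚ
open import Data.Rational.Unnormalised as ℚᵘ using (mkℚᵘ; *≡*; *≤*)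
import Data.Rational.Unnormalised.Properties as ℚᵘ
open import Function.Bundles using (Equivalence)
open import Relation.Binary.PropositionalEquality
open import Relation.Nullary using (yes; no)
open import Relation.Nullary.Decidable using (⌊_⌋; toWitness; fromWitness)

sumℕ-cong : ∀ k {f g : Fin k → ℕ} → (∀ i → f i ≡ g i) → sumℕ k f ≡ sumℕ k g
sumℕ-cong zero    f≡g = refl
sumℕ-cong (suc k) f≡g = cong₂ _+_ (f≡g zero) (sumℕ-cong k (λ i → f≡g (suc i)))

sumℕ-mono : ∀ k {f g : Fin k → ℕ} → (∀ i → f i ≤ g i) → sumℕ k f ≤ sumℕ k g
sumℕ-mono zero    f≤g = z≤n
sumℕ-mono (suc k) f≤g = +-mono-≤ (f≤g zero) (sumℕ-mono k (λ i → f≤g (suc i)))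

sumℕ-const : ∀ k c → sumℕ k (λ _ → c) ≡ k * c
sumℕ-const zero    c = refl
sumℕ-const (suc k) c = cong (c +_) (sumℕ-const k c)

sumℕ-zero : ∀ k → sumℕ k (λ _ → 0) ≡ 0
sumℕ-zero k = trans (sumℕ-const k 0) (*-zeroʳ k)

sumℕ-one : ∀ k → sumℕ k (λ _ → 1) ≡ k
sumℕ-one k = trans (sumℕ-const k 1) (*-identityʳ k)

sumℕ-+ : ∀ k (f g : Fin k → ℕ) → sumℕ k (λ i → f i + g i) ≡ sumℕ k f + sumℕ k g
sumℕ-+ zero    f g = refl
sumℕ-+ (suc k) f g = begin
  (f zero + g zero) + sumℕ k (λ i → f (suc i) + g (suc i))
    ≡⟨ cong ((f zero + g zero) +_) (sumℕ-+ k (λ i → f (suc i)) (λ i → g (suc i))) ⟩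
  (f zero + g zero) + (sumℕ k (λ i → f (suc i)) + sumℕ k (λ i → g (suc i)))
    ≡⟨ +-interchange (f zero) (g zero) _ _ ⟩
  (f zero + sumℕ k (λ i → f (suc i))) + (g zero + sumℕ k (λ i → g (suc i))) ∎
  where
  open ≡-Reasoning
  +-interchange : ∀ a b c d → (a + b) + (c + d) ≡ (a + c) + (b + d)
  +-interchange = ℕ-Solver.solve-∀

sumℕ-comm : ∀ a b (f : Fin a → Fin b → ℕ) →
  sumℕ a (λ i → sumℕ b (f i)) ≡ sumℕ b (λ j → sumℕ a (λ i → f i j))
sumℕ-comm zero    b f = sym (sumℕ-zero b)
sumℕ-comm (suc a) b f = trans
  (cong (sumℕ b (f zero) +_) (sumℕ-comm a b (λ i → f (suc i))))
  (sym (sumℕ-+ b (f zero) (λ j → sumℕ a (λ i → f (suc i) j))))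

term≤sumℕ : ∀ k (f : Fin k → ℕ) i → f i ≤ sumℕ k f
term≤sumℕ (suc k) f zero    = m≤m+n (f zero) _
term≤sumℕ (suc k) f (suc i) = ≤-trans (term≤sumℕ k (λ j → f (suc j)) i) (m≤n+m _ (f zero))

choose₂ : ℕ → ℕ
choose₂ zero    = 0
choose₂ (suc s) = s + choose₂ s

choose₂-suc-*2 : ∀ m → choose₂ (suc m) * 2 ≡ m * suc m
choose₂-suc-*2 zero    = refl
choose₂-suc-*2 (suc m) = begin
  (suc m + choose₂ (suc m)) * 2     ≡⟨ *-distribʳ-+ 2 (suc m) (choose₂ (suc m)) ⟩
  suc m * 2 + choose₂ (suc m) * 2   ≡⟨ cong (suc m * 2 +_) (choose₂-suc-*2 m) ⟩
  suc m * 2 + m * suc m             ≡⟨ ring m ⟩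
  suc m * suc (suc m)               ∎
  where
  open ≡-Reasoning
  ring : ∀ m → suc m * 2 + m * suc m ≡ suc m * suc (suc m)
  ring = ℕ-Solver.solve-∀

pairsIn : ∀ {n} → Subset n → ℕ
pairsIn {n} S = sumℕ n (λ u → sumℕ n (λ v → toN (S u ∧ S v ∧ (toℕ u <ᵇ toℕ v))))

pairsIn-suc : ∀ n (S : Subset (suc n)) →
  pairsIn S ≡ toN (S zero) * card {n} (λ u → S (suc u)) + pairsIn {n} (λ u → S (suc u))
pairsIn-suc n S = cong₂ _+_ pairs-with-zero pairs-without-zero
  where
  -- zero precedes every suc v and follows nothing, so its row counts its partners in S
  -- and its column contributes nothing.
  pairs-with-zero : toN (S zero ∧ S zero ∧ false) + sumℕ n (λ v → toN (S zero ∧ S (suc v) ∧ true))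
                  ≡ toN (S zero) * card {n} (λ u → S (suc u))
  pairs-with-zero with S zero
  ... | false = sumℕ-zero n
  ... | true  = trans (sumℕ-cong n (λ v → cong toN (∧-identityʳ (S (suc v)))))
                      (sym (+-identityʳ _))
  pairs-without-zero :
    sumℕ n (λ u → toN (S (suc u) ∧ S zero ∧ false)
                  + sumℕ n (λ v → toN (S (suc u) ∧ S (suc v) ∧ (toℕ u <ᵇ toℕ v))))
    ≡ pairsIn {n} (λ u → S (suc u))
  pairs-without-zero = sumℕ-cong n (λ u →
    cong (λ b → toN b + sumℕ n (λ v → toN (S (suc u) ∧ S (suc v) ∧ (toℕ u <ᵇ toℕ v))))
    (trans (cong (S (suc u) ∧_) (∧-zeroʳ (S zero))) (∧-zeroʳ (S (suc u)))))

pairsIn≡choose₂ : ∀ n (S : Subset n) → pairsIn S ≡ choose₂ (card S)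
pairsIn≡choose₂ zero    S = refl
pairsIn≡choose₂ (suc n) S = trans (pairsIn-suc n S) (add-element (S zero))
  where
  c : ℕ
  c = card {n} (λ u → S (suc u))
  add-element : ∀ b → toN b * c + pairsIn {n} (λ u → S (suc u)) ≡ choose₂ (toN b + c)
  add-element false = pairsIn≡choose₂ n (λ u → S (suc u))
  add-element true  = cong₂ _+_ (+-identityʳ c) (pairsIn≡choose₂ n (λ u → S (suc u)))

toN-∧-≤ʳ : ∀ a b → toN (a ∧ b) ≤ toN b
toN-∧-≤ʳ false false = z≤n
toN-∧-≤ʳ false true  = z≤n
toN-∧-≤ʳ true  b     = ≤-refl

toN-∧-≡ʳ : ∀ a b → (b ≡ true → a ≡ true) → toN (a ∧ b) ≡ toN b
toN-∧-≡ʳ a     true  b⇒a rewrite b⇒a refl = refl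
toN-∧-≡ʳ false false b⇒a = refl
toN-∧-≡ʳ true  false b⇒a = refl

edgesIn≤choose₂ : ∀ {n} (G : Graph n) S → edgesIn G S ≤ choose₂ (card S)
edgesIn≤choose₂ {n} G S = ≤-trans
  (sumℕ-mono n (λ u → sumℕ-mono n (λ v → toN-∧-≤ʳ (adj G u v) _)))
  (≤-reflexive (pairsIn≡choose₂ n S))

IsClique : ∀ {n} → Graph n → Subset n → Set
IsClique G S = ∀ u v → S u ≡ true → S v ≡ true → u ≢ v → adj G u v ≡ true

edgesIn-clique : ∀ {n} (G : Graph n) S → IsClique G S → edgesIn G S ≡ choose₂ (card S)
edgesIn-clique {n} G S clique = trans
  (sumℕ-cong n (λ u → sumℕ-cong n (λ v → toN-∧-≡ʳ (adj G u v) _ (pair⇒adj u v))))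
  (pairsIn≡choose₂ n S)
  where
  pair⇒adj : ∀ u v → (S u ∧ S v ∧ (toℕ u <ᵇ toℕ v)) ≡ true → adj G u v ≡ true
  pair⇒adj u v p = clique u v (∧-conicalˡ (S u) _ p) (∧-conicalˡ (S v) _ rest) u≢v
    where
    rest : (S v ∧ (toℕ u <ᵇ toℕ v)) ≡ true
    rest = ∧-conicalʳ (S u) (S v ∧ (toℕ u <ᵇ toℕ v)) p
    u<v : T (toℕ u <ᵇ toℕ v)
    u<v = Equivalence.from T-≡ (∧-conicalʳ (S v) _ rest)
    u≢v : u ≢ v
    u≢v refl = <-irrefl refl (<ᵇ⇒< (toℕ u) (toℕ u) u<v)

sumℕ-indicator : ∀ t (a : Fin t) → sumℕ t (λ i → toN ⌊ a ≟ᶠ i ⌋) ≡ 1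
sumℕ-indicator (suc t) zero    = cong suc (sumℕ-zero t)
sumℕ-indicator (suc t) (suc a) =
  trans (sumℕ-cong t (λ i → cong toN (suc≟suc a i))) (sumℕ-indicator t a)
  where
  suc≟suc : ∀ a i → ⌊ suc a ≟ᶠ suc i ⌋ ≡ ⌊ a ≟ᶠ i ⌋
  suc≟suc a i with a ≟ᶠ i
  ... | yes _ = refl
  ... | no  _ = refl

sumℕ-card-part : ∀ {n t} (P : Partition n t) → sumℕ t (λ i → card (part P i)) ≡ n
sumℕ-card-part {n} {t} P = begin
  sumℕ t (λ i → sumℕ n (λ u → toN ⌊ label P u ≟ᶠ i ⌋))
    ≡⟨ sumℕ-comm t n (λ i u → toN ⌊ label P u ≟ᶠ i ⌋) ⟩
  sumℕ n (λ u → sumℕ t (λ i → toN ⌊ label P u ≟ᶠ i ⌋))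
    ≡⟨ sumℕ-cong n (λ u → sumℕ-indicator t (label P u)) ⟩
  sumℕ n (λ _ → 1)
    ≡⟨ sumℕ-one n ⟩
  n ∎
  where open ≡-Reasoning

label≡⇒∈part : ∀ {n t} (P : Partition n t) {i u} → label P u ≡ i → part P i u ≡ true
label≡⇒∈part P {i} {u} label≡i = Equivalence.to T-≡ (fromWitness {a? = label P u ≟ᶠ i} label≡i)

∈part⇒label≡ : ∀ {n t} (P : Partition n t) {i u} → part P i u ≡ true → label P u ≡ i
∈part⇒label≡ P {i} {u} u∈i = toWitness {a? = label P u ≟ᶠ i} (Equivalence.from T-≡ u∈i)

card-part-pos : ∀ {n t} (P : Partition n t) i → 1 ≤ card (part P i)
card-part-pos {n} P i with nonempty P i
... | u , label≡i = ≤-trans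
  (≤-reflexive (cong toN (sym (label≡⇒∈part P (label≡i refl)))))
  (term≤sumℕ n (λ v → toN (part P i v)) u)

sumℕ-card-part-∸1 : ∀ {n t} (P : Partition n t) → sumℕ t (λ i → card (part P i) ∸ 1) ≡ n ∸ t
sumℕ-card-part-∸1 {n} {t} P = begin
  sumℕ t m                       ≡⟨ m+n∸m≡n t (sumℕ t m) ⟨
  (t + sumℕ t m) ∸ t             ≡⟨ cong (_∸ t) t+Σm≡n ⟩
  n ∸ t                          ∎
  where
  open ≡-Reasoning
  m : Fin t → ℕ
  m i = card (part P i) ∸ 1
  t+Σm≡n : t + sumℕ t m ≡ n
  t+Σm≡n = begin
    t + sumℕ t m                      ≡⟨ cong (_+ sumℕ t m) (sumℕ-one t) ⟨
    sumℕ t (λ _ → 1) + sumℕ t m       ≡⟨ sumℕ-+ t (λ _ → 1) m ⟨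
    sumℕ t (λ i → 1 + m i)            ≡⟨ sumℕ-cong t (λ i → m+[n∸m]≡n (card-part-pos P i)) ⟩
    sumℕ t (λ i → card (part P i))    ≡⟨ sumℕ-card-part P ⟩
    n                                 ∎

fromℚᵘ-mono-≤ : ∀ {p q} → p ℚᵘ.≤ q → fromℚᵘ p ≤ℚ fromℚᵘ q
fromℚᵘ-mono-≤ {p} {q} p≤q = ℚ.toℚᵘ-cancel-≤
  (ℚᵘ.≤-respˡ-≃ (ℚᵘ.≃-sym (ℚ.toℚᵘ-fromℚᵘ p))
  (ℚᵘ.≤-respʳ-≃ (ℚᵘ.≃-sym (ℚ.toℚᵘ-fromℚᵘ q)) p≤q))

ratio-monoˡ : ∀ {e e'} s → e ≤ e' → ratio e s ≤ℚ ratio e' s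
ratio-monoˡ zero    e≤e' = ℚ.≤-refl
ratio-monoˡ {e} {e'} (suc s) e≤e' =
  fromℚᵘ-mono-≤ {mkℚᵘ (ℤ.+ e) s} {mkℚᵘ (ℤ.+ e') s}
    (*≤* (ℤ.*-monoʳ-≤-nonNeg (ℤ.+ suc s) (ℤ.+≤+ e≤e')))

half : ℕ → ℚ
half m = ℤ.+ m ℚ./ 2

half-+ : ∀ a b → half (a + b) ≡ half a ℚ.+ half b
half-+ a b = ℚ.toℚᵘ-injective (begin
  toℚᵘ (half (a + b))                    ≈⟨ ℚ.toℚᵘ-fromℚᵘ (mkℚᵘ (ℤ.+ (a + b)) 1) ⟩
  mkℚᵘ (ℤ.+ (a + b)) 1                   ≈⟨ *≡* (ring-identity (ℤ.+ a) (ℤ.+ b)) ⟩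
  mkℚᵘ (ℤ.+ a) 1 ℚᵘ.+ mkℚᵘ (ℤ.+ b) 1     ≈⟨ ℚᵘ.+-cong (ℚ.toℚᵘ-fromℚᵘ (mkℚᵘ (ℤ.+ a) 1))
                                                      (ℚ.toℚᵘ-fromℚᵘ (mkℚᵘ (ℤ.+ b) 1)) ⟨
  toℚᵘ (half a) ℚᵘ.+ toℚᵘ (half b)       ≈⟨ ℚ.toℚᵘ-homo-+ (half a) (half b) ⟨
  toℚᵘ (half a ℚ.+ half b)               ∎)
  where
  open ℚᵘ.≃-Reasoning
  ring-identity : ∀ x y → (x ℤ.+ y) ℤ.* ℤ.+ 4 ≡ (x ℤ.* ℤ.+ 2 ℤ.+ y ℤ.* ℤ.+ 2) ℤ.* ℤ.+ 2
  ring-identity = ℤ-Solver.solve-∀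

sumℚ-mono : ∀ k {f g : Fin k → ℚ} → (∀ i → f i ≤ℚ g i) → sumℚ k f ≤ℚ sumℚ k g
sumℚ-mono zero    f≤g = ℚ.≤-refl
sumℚ-mono (suc k) f≤g = ℚ.+-mono-≤ (f≤g zero) (sumℚ-mono k (λ i → f≤g (suc i)))

sumℚ-cong : ∀ k {f g : Fin k → ℚ} → (∀ i → f i ≡ g i) → sumℚ k f ≡ sumℚ k g
sumℚ-cong zero    f≡g = refl
sumℚ-cong (suc k) f≡g = cong₂ ℚ._+_ (f≡g zero) (sumℚ-cong k (λ i → f≡g (suc i)))

sumℚ-half : ∀ k (m : Fin k → ℕ) → sumℚ k (λ i → half (m i)) ≡ half (sumℕ k m)
sumℚ-half zero    m = refl
sumℚ-half (suc k) m =
  trans (cong (half (m zero) ℚ.+_) (sumℚ-half k (λ i → m (suc i)))) (sym (half-+ (m zero) _))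

ratio-choose₂ : ∀ s → ratio (choose₂ s) s ≡ half (s ∸ 1)
ratio-choose₂ zero    = refl
ratio-choose₂ (suc m) =
  ℚ.fromℚᵘ-cong {mkℚᵘ (ℤ.+ choose₂ (suc m)) m} {mkℚᵘ (ℤ.+ m) 1} (*≡* (begin
  ℤ.+ choose₂ (suc m) ℤ.* ℤ.+ 2   ≡⟨ ℤ.pos-* (choose₂ (suc m)) 2 ⟨
  ℤ.+ (choose₂ (suc m) * 2)       ≡⟨ cong ℤ.+_ (choose₂-suc-*2 m) ⟩
  ℤ.+ (m * suc m)                 ≡⟨ ℤ.pos-* m (suc m) ⟩
  ℤ.+ m ℤ.* ℤ.+ suc m             ∎))
  where open ≡-Reasoning

density≤half : ∀ {n} (G : Graph n) S → density G S ≤ℚ half (card S ∸ 1)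
density≤half G S = ℚ.≤-trans
  (ratio-monoˡ (card S) (edgesIn≤choose₂ G S))
  (ℚ.≤-reflexive (ratio-choose₂ (card S)))

density-clique : ∀ {n} (G : Graph n) S → IsClique G S → density G S ≡ half (card S ∸ 1)
density-clique G S clique =
  trans (cong (λ e → ratio e (card S)) (edgesIn-clique G S clique)) (ratio-choose₂ (card S))

sumℚ-half-card-part : ∀ {n t} (P : Partition n t) →
  sumℚ t (λ i → half (card (part P i) ∸ 1)) ≡ half (n ∸ t)
sumℚ-half-card-part {t = t} P =
  trans (sumℚ-half t (λ i → card (part P i) ∸ 1)) (cong half (sumℕ-card-part-∸1 P))

partDensity≤half : ∀ {n t} (G : Graph n) (Q : Partition n t) → partDensity G Q ≤ℚ half (n ∸ t)
partDensity≤half {t = t} G Q = ℚ.≤-trans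
  (sumℚ-mono t (λ i → density≤half G (part Q i)))
  (ℚ.≤-reflexive (sumℚ-half-card-part Q))

partDensity-cliquePartition : ∀ {n t} (G : Graph n) (P : Partition n t) →
  IsCliquePartition G P → partDensity G P ≡ half (n ∸ t)
partDensity-cliquePartition {t = t} G P clique = trans
  (sumℚ-cong t (λ i → density-clique G (part P i) (part-isClique i)))
  (sumℚ-half-card-part P)
  where
  part-isClique : ∀ i → IsClique G (part P i)
  part-isClique i u v u∈i v∈i =
    clique u v (trans (∈part⇒label≡ P u∈i) (sym (∈part⇒label≡ P v∈i)))

lemma2 : (n : ℕ) (G : Graph n) (t : ℕ) → 2 ≤ t →
    Σ (Partition n t) (λ P₀ → IsCliquePartition G P₀) →
    (P : Partition n t) → IsCliquePartition G P →
    (Q : Partition n t) → partDensity G Q ≤ℚ partDensity G P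
lemma2 n G t _ _ P clique Q = ℚ.≤-trans
  (partDensity≤half G Q)
  (ℚ.≤-reflexive (sym (partDensity-cliquePartition G P clique)))
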